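{- Let $n_1,n_2\ge 3$ be relatively prime integers. Then $c^-(C_{n_1}\,\Box\,C_{n_2})=2$.
   Context: All graphs are finite, undirected and reflexive. The semi-active Cops and Robbers game is the ordinary game (cops place first, then the robber; in rounds, each cop moves to an adjacent vertex or stays put, then the robber moves; cops win by occupying the robber's vertex) except that on each of his turns the robber must move to an adjacent vertex different from his current one. $c^-(G)$ is the minimum number of cops that can guarantee capture in the semi-active game on $G$. $C_n$ is the cycle on $n$ vertices and $\Box$ denotes the Cartesian product of graphs. -}

module Defs where

open import Data.Nat using (ℕ; suc; _<_)
open import Data.Fin using (Fin; toℕ)
open import Data.Product using (Σ; ∃; _×_; _,_)
open import Data.Sum using (_⊎_)
open import Relation.Binary.PropositionalEquality using (_≡_)
open import Relation.Nullary using (¬_)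

-- A (reflexive, undirected) graph: vertex type and adjacency relation.
-- Adjacency includes loops (reflexive graph): staying put is a move to an adjacent vertex.
record Graph : Set₁ where
  field
    V   : Set
    Adj : V → V → Set
open Graph public

CycleAdj : (n : ℕ) → Fin n → Fin n → Set
CycleAdj n i j =
  i ≡ j
  ⊎ suc (toℕ i) ≡ toℕ j
  ⊎ suc (toℕ j) ≡ toℕ i
  ⊎ (toℕ i ≡ 0 × suc (toℕ j) ≡ n)
  ⊎ (toℕ j ≡ 0 × suc (toℕ i) ≡ n)

Cycle : ℕ → Graph
Cycle n = record { V = Fin n ; Adj = CycleAdj n }

_□_ : Graph → Graph → Graph
G □ H = record
  { V = V G × V H
  ; Adj = λ { (u₁ , u₂) (v₁ , v₂) → (u₁ ≡ v₁ × Adj H u₂ v₂) ⊎ (Adj G u₁ v₁ × u₂ ≡ v₂) } }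

module _ (G : Graph) where

  Cops : ℕ → Set
  Cops k = Fin k → V G

  Caught : {k : ℕ} → Cops k → V G → Set
  Caught cs r = ∃ λ i → cs i ≡ r

  CopStep : {k : ℕ} → Cops k → Cops k → Set
  CopStep cs cs' = ∀ i → Adj G (cs i) (cs' i)

  -- CopsWin cs r : it is the cops' turn, cops at cs, robber at r, and the cops
  -- can force capture in the semi-active game (robber must move to an
  -- adjacent vertex different from his current one). Inductive = capture is
  -- guaranteed in finitely many rounds.
  data CopsWin {k : ℕ} : Cops k → V G → Set where
    caught : ∀ {cs r} → Caught cs r → CopsWin cs r
    move   : ∀ {cs r} (cs' : Cops k) → CopStep cs cs' →
             (Caught cs' r ⊎
              (∀ r' → Adj G r r' → ¬ (r' ≡ r) → CopsWin cs' r')) →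
             CopsWin cs r

  SemiActiveCopWin : ℕ → Set
  SemiActiveCopWin k = Σ (Cops k) λ cs → ∀ r → CopsWin cs r

  SemiActiveCopNumber : ℕ → Set
  SemiActiveCopNumber k = SemiActiveCopWin k × (∀ j → j < k → ¬ SemiActiveCopWin j)

{-# OPTIONS --safe #-}

-- Identify C n₁ □ C n₂ with ℤ/n₁ × ℤ/n₂ and let τ₁, τ₂ be the translations by (1, 0) and (0, 1).
-- As n₁ and n₂ are coprime, the diagonal translation τ₁ τ₂ has a single orbit (Chinese remainder
-- theorem), so two cops can start in a position where the robber sits on the diagonal between
-- them: the first cop a > 0 diagonal steps ahead of the robber, the robber b > 0 diagonal steps
-- ahead of the second cop. Since the robber must move, he steps along τ₁ or τ₂ or back; one cop
-- copies that step and the other steps back or forth along the complementary generator, which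
-- restores the configuration with a or b lowered by one. Hence the robber is caught within a + b
-- rounds. A single cop loses when both cycles have length at least 3: a robber who is not adjacent
-- to the cop can always step to a vertex not adjacent to the cop's new position.

module Submission where

open import Defs
open import Data.Nat using (ℕ; zero; suc; _+_; _*_; _∸_; _≤_; _<_; s≤s; z≤n)
open import Data.Nat.Properties
  using (+-comm; +-assoc; *-assoc; *-suc; +-identityʳ; m∸n+n≡m; <⇒≤; <⇒≢; m≤n⇒m<n∨m≡n)
open import Data.Nat.DivMod
  using (_%_; _mod_; %-distribˡ-+; m%n%n≡m%n; [m+n]%n≡m%n; n%n≡0; m<n⇒m%n≡m)
open import Data.Nat.Coprimality using (Coprime; coprime-Bézout)
open import Data.Nat.GCD using (module Bézout)
open import Data.Fin using (Fin; zero; suc; toℕ)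
open import Data.Fin.Properties using (toℕ-injective; toℕ-fromℕ<; toℕ<n; _≟_)
open import Data.Product using (∃; ∃₂; _×_; _,_; map; map₁; map₂)
open import Data.Product.Properties using (,-injectiveˡ; ,-injectiveʳ)
open import Data.Sum using (_⊎_; inj₁; inj₂)
open import Data.Vec.Functional using ([]; _∷_)
open import Data.Empty using (⊥-elim)
open import Function using (_∘_)
open import Function.Definitions using (Injective)
import Function.Endo.Propositional as Endo
open import Relation.Binary.Definitions using (Reflexive; Symmetric)
open import Relation.Binary.PropositionalEquality
  using (_≡_; _≢_; refl; sym; trans; cong; cong₂; cong-app; subst; module ≡-Reasoning)
open import Relation.Nullary using (¬_; yes; no)

open ≡-Reasoning

infixr 8 _^_

_^_ : {A : Set} → (A → A) → ℕ → A → A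
_^_ {A} = Endo._^_ A

^-+ : {A : Set} (f : A → A) (m n : ℕ) (x : A) → (f ^ (m + n)) x ≡ (f ^ m) ((f ^ n) x)
^-+ {A} f m n = cong-app (Endo.^-homo A f m n)

^-comm : {A : Set} (f : A → A) (m n : ℕ) (x : A) → (f ^ m) ((f ^ n) x) ≡ (f ^ n) ((f ^ m) x)
^-comm f m n x = begin
  (f ^ m) ((f ^ n) x)  ≡⟨ ^-+ f m n x ⟨
  (f ^ (m + n)) x      ≡⟨ cong (λ k → (f ^ k) x) (+-comm m n) ⟩
  (f ^ (n + m)) x      ≡⟨ ^-+ f n m x ⟩
  (f ^ n) ((f ^ m) x)  ∎

Periodic : {A : Set} → (A → A) → ℕ → Set
Periodic f p = ∀ x → (f ^ p) x ≡ x

SingleOrbit : {A : Set} → (A → A) → Set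
SingleOrbit f = ∀ x y → ∃ λ k → (f ^ k) x ≡ y

periodic-multiple : {A : Set} {f : A → A} {p : ℕ} → Periodic f p → ∀ k → Periodic f (k * p)
periodic-multiple per zero    x = refl
periodic-multiple {f = f} {p} per (suc k) x = begin
  (f ^ (p + k * p)) x        ≡⟨ ^-+ f p (k * p) x ⟩
  (f ^ p) ((f ^ (k * p)) x)  ≡⟨ cong (f ^ p) (periodic-multiple per k x) ⟩
  (f ^ p) x                  ≡⟨ per x ⟩
  x                          ∎

map-^ : {A B : Set} (f : A → A) (g : B → B) (k : ℕ) (a : A) (b : B) →
        (map f g ^ k) (a , b) ≡ ((f ^ k) a , (g ^ k) b)
map-^ f g zero    a b = refl
map-^ f g (suc k) a b = cong (map f g) (map-^ f g k a b)

module _ {A B : Set} {f : A → A} {g : B → B} {p q : ℕ}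
         (f-periodic : Periodic f p) (g-periodic : Periodic g q)
         (f-orbit : SingleOrbit f) (g-orbit : SingleOrbit g) where

  -- The witness is j * (s * p) + i, where s * p is ≡ 0 modulo p and ≡ 1 modulo q.
  reach-both-Bézout : ∀ s t → 1 + t * q ≡ s * p →
                      ∀ a₁ b₁ a₂ b₂ → ∃ λ k → (f ^ k) a₁ ≡ b₁ × (g ^ k) a₂ ≡ b₂
  reach-both-Bézout s t bézout a₁ b₁ a₂ b₂ with f-orbit a₁ b₁
  ... | i , fⁱa₁≡b₁ with g-orbit ((g ^ i) a₂) b₂
  ... | j , gʲgⁱa₂≡b₂ = j * (s * p) + i , f-reach , g-reach
    where
    f-reach : (f ^ (j * (s * p) + i)) a₁ ≡ b₁
    f-reach = begin
      (f ^ (j * (s * p) + i)) a₁        ≡⟨ ^-+ f (j * (s * p)) i a₁ ⟩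
      (f ^ (j * (s * p))) ((f ^ i) a₁)  ≡⟨ cong (f ^ (j * (s * p))) fⁱa₁≡b₁ ⟩
      (f ^ (j * (s * p))) b₁            ≡⟨ cong (λ k → (f ^ k) b₁) (*-assoc j s p) ⟨
      (f ^ (j * s * p)) b₁              ≡⟨ periodic-multiple f-periodic (j * s) b₁ ⟩
      b₁                                ∎

    jsp≡j+jtq : j * (s * p) ≡ j + j * t * q
    jsp≡j+jtq = begin
      j * (s * p)        ≡⟨ cong (j *_) bézout ⟨
      j * suc (t * q)    ≡⟨ *-suc j (t * q) ⟩
      j + j * (t * q)    ≡⟨ cong (j +_) (*-assoc j t q) ⟨
      j + j * t * q      ∎

    g-reach : (g ^ (j * (s * p) + i)) a₂ ≡ b₂
    g-reach = begin
      (g ^ (j * (s * p) + i)) a₂                 ≡⟨ cong (λ k → (g ^ (k + i)) a₂) jsp≡j+jtq ⟩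
      (g ^ (j + j * t * q + i)) a₂               ≡⟨ ^-+ g (j + j * t * q) i a₂ ⟩
      (g ^ (j + j * t * q)) ((g ^ i) a₂)         ≡⟨ ^-+ g j (j * t * q) ((g ^ i) a₂) ⟩
      (g ^ j) ((g ^ (j * t * q)) ((g ^ i) a₂))   ≡⟨ cong (g ^ j) (periodic-multiple g-periodic (j * t) _) ⟩
      (g ^ j) ((g ^ i) a₂)                       ≡⟨ gʲgⁱa₂≡b₂ ⟩
      b₂                                         ∎

reach-both : {A B : Set} {f : A → A} {g : B → B} {p q : ℕ} → Coprime p q →
             Periodic f p → Periodic g q → SingleOrbit f → SingleOrbit g →
             ∀ a₁ b₁ a₂ b₂ → ∃ λ k → (f ^ k) a₁ ≡ b₁ × (g ^ k) a₂ ≡ b₂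
reach-both coprime f-periodic g-periodic f-orbit g-orbit a₁ b₁ a₂ b₂ with coprime-Bézout coprime
... | Bézout.+- s t bézout =
  reach-both-Bézout f-periodic g-periodic f-orbit g-orbit s t bézout a₁ b₁ a₂ b₂
... | Bézout.-+ t s bézout
  with reach-both-Bézout g-periodic f-periodic g-orbit f-orbit s t bézout a₂ b₂ a₁ b₁
...   | k , gᵏa₂≡b₂ , fᵏa₁≡b₁ = k , fᵏa₁≡b₁ , gᵏa₂≡b₂

map-singleOrbit : {A B : Set} {f : A → A} {g : B → B} {p q : ℕ} → Coprime p q →
                  Periodic f p → Periodic g q → SingleOrbit f → SingleOrbit g →
                  SingleOrbit (map f g)
map-singleOrbit {f = f} {g} coprime f-periodic g-periodic f-orbit g-orbit (a₁ , a₂) (b₁ , b₂)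
  with reach-both coprime f-periodic g-periodic f-orbit g-orbit a₁ b₁ a₂ b₂
... | k , fᵏa₁≡b₁ , gᵏa₂≡b₂ = k , trans (map-^ f g k a₁ a₂) (cong₂ _,_ fᵏa₁≡b₁ gᵏa₂≡b₂)

module _ {m : ℕ} where

  σ : Fin (suc m) → Fin (suc m)
  σ i = suc (toℕ i) mod suc m

  π : Fin (suc m) → Fin (suc m)
  π = σ ^ m

  toℕ-σ : ∀ i → toℕ (σ i) ≡ suc (toℕ i) % suc m
  toℕ-σ i = toℕ-fromℕ< _

  toℕ%n : ∀ (i : Fin (suc m)) → toℕ i % suc m ≡ toℕ i
  toℕ%n i = m<n⇒m%n≡m (toℕ<n i)

  toℕ-σ^ : ∀ k i → toℕ ((σ ^ k) i) ≡ (k + toℕ i) % suc m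
  toℕ-σ^ zero    i = sym (toℕ%n i)
  toℕ-σ^ (suc k) i = begin
    toℕ (σ ((σ ^ k) i))                 ≡⟨ toℕ-σ ((σ ^ k) i) ⟩
    suc (toℕ ((σ ^ k) i)) % suc m       ≡⟨ cong (λ t → suc t % suc m) (toℕ-σ^ k i) ⟩
    (1 + (k + toℕ i) % suc m) % suc m   ≡⟨ %-distribˡ-+ 1 ((k + toℕ i) % suc m) (suc m) ⟩
    (1 % suc m + (k + toℕ i) % suc m % suc m) % suc m
        ≡⟨ cong (λ t → (1 % suc m + t) % suc m) (m%n%n≡m%n (k + toℕ i) (suc m)) ⟩
    (1 % suc m + (k + toℕ i) % suc m) % suc m ≡⟨ %-distribˡ-+ 1 (k + toℕ i) (suc m) ⟨
    suc (k + toℕ i) % suc m             ∎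

  σ^-toℕ : ∀ k i j → (k + toℕ i) % suc m ≡ toℕ j → (σ ^ k) i ≡ j
  σ^-toℕ k i j e = toℕ-injective (trans (toℕ-σ^ k i) e)

  σ-periodic : Periodic σ (suc m)
  σ-periodic i = σ^-toℕ (suc m) i i (begin
    (suc m + toℕ i) % suc m  ≡⟨ cong (_% suc m) (+-comm (suc m) (toℕ i)) ⟩
    (toℕ i + suc m) % suc m  ≡⟨ [m+n]%n≡m%n (toℕ i) (suc m) ⟩
    toℕ i % suc m            ≡⟨ toℕ%n i ⟩
    toℕ i                    ∎)

  σ-singleOrbit : SingleOrbit σ
  σ-singleOrbit i j = toℕ j + (suc m ∸ toℕ i) , σ^-toℕ (toℕ j + (suc m ∸ toℕ i)) i j (begin
    (toℕ j + (suc m ∸ toℕ i) + toℕ i) % suc m    ≡⟨ cong (_% suc m) (+-assoc (toℕ j) _ (toℕ i)) ⟩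
    (toℕ j + (suc m ∸ toℕ i + toℕ i)) % suc m    ≡⟨ cong (_% suc m) (cong (toℕ j +_) (m∸n+n≡m (<⇒≤ (toℕ<n i)))) ⟩
    (toℕ j + suc m) % suc m                      ≡⟨ [m+n]%n≡m%n (toℕ j) (suc m) ⟩
    toℕ j % suc m                                ≡⟨ toℕ%n j ⟩
    toℕ j                                        ∎)

  σ-π : ∀ i → σ (π i) ≡ i
  σ-π = σ-periodic

  π-σ : ∀ i → π (σ i) ≡ i
  π-σ i = trans (^-comm σ m 1 i) (σ-periodic i)

  σ-injective : Injective _≡_ _≡_ σ
  σ-injective {i} {j} σi≡σj = begin
    i          ≡⟨ π-σ i ⟨
    π (σ i)    ≡⟨ cong π σi≡σj ⟩
    π (σ j)    ≡⟨ π-σ j ⟩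
    j          ∎

  σ^-fixed-point-free : ∀ {k} → 0 < k → k < suc m → ∀ i → (σ ^ k) i ≢ i
  σ^-fixed-point-free {k} 0<k k<n i σᵏi≡i = <⇒≢ 0<k (sym k≡0)
    where
    -- σ ^ k commutes with σ, so fixing one point it fixes the whole orbit, in particular zero.
    σᵏ0≡0 : (σ ^ k) zero ≡ zero
    σᵏ0≡0 with σ-singleOrbit i zero
    ... | t , σᵗi≡0 = begin
      (σ ^ k) zero              ≡⟨ cong (σ ^ k) σᵗi≡0 ⟨
      (σ ^ k) ((σ ^ t) i)       ≡⟨ ^-comm σ k t i ⟩
      (σ ^ t) ((σ ^ k) i)       ≡⟨ cong (σ ^ t) σᵏi≡i ⟩
      (σ ^ t) i                 ≡⟨ σᵗi≡0 ⟩
      zero                      ∎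

    k≡0 : k ≡ 0
    k≡0 = begin
      k                    ≡⟨ m<n⇒m%n≡m k<n ⟨
      k % suc m            ≡⟨ cong (_% suc m) (+-identityʳ k) ⟨
      (k + 0) % suc m      ≡⟨ toℕ-σ^ k zero ⟨
      toℕ ((σ ^ k) zero)   ≡⟨ cong toℕ σᵏ0≡0 ⟩
      0                    ∎

  σi≢i : 0 < m → ∀ i → σ i ≢ i
  σi≢i 0<m = σ^-fixed-point-free {1} (s≤s z≤n) (s≤s 0<m)

  πi≢i : 0 < m → ∀ i → π i ≢ i
  πi≢i 0<m i πi≡i = σi≢i 0<m i (trans (cong σ (sym πi≡i)) (σ-π i))

  σi≢πi : 1 < m → ∀ i → σ i ≢ π i
  σi≢πi 1<m i σi≡πi = σ^-fixed-point-free {2} (s≤s z≤n) (s≤s 1<m) i (trans (cong σ σi≡πi) (σ-π i))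

  σ-cases : ∀ i → suc (toℕ i) ≡ toℕ (σ i) ⊎ (toℕ (σ i) ≡ 0 × suc (toℕ i) ≡ suc m)
  σ-cases i with m≤n⇒m<n∨m≡n (toℕ<n i)
  ... | inj₁ 1+i<n = inj₁ (sym (trans (toℕ-σ i) (m<n⇒m%n≡m 1+i<n)))
  ... | inj₂ 1+i≡n = inj₂ (trans (toℕ-σ i) (trans (cong (_% suc m) 1+i≡n) (n%n≡0 (suc m))) , 1+i≡n)

  step⇒σ : ∀ {i j} → suc (toℕ i) ≡ toℕ j → j ≡ σ i
  step⇒σ {i} {j} 1+i≡j = toℕ-injective (begin
    toℕ j                ≡⟨ toℕ%n j ⟨
    toℕ j % suc m        ≡⟨ cong (_% suc m) 1+i≡j ⟨
    suc (toℕ i) % suc m  ≡⟨ toℕ-σ i ⟨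
    toℕ (σ i)            ∎)

  wrap⇒σ : ∀ {i j} → toℕ j ≡ 0 → suc (toℕ i) ≡ suc m → j ≡ σ i
  wrap⇒σ {i} {j} j≡0 1+i≡n = toℕ-injective (begin
    toℕ j                ≡⟨ j≡0 ⟩
    0                    ≡⟨ n%n≡0 (suc m) ⟨
    suc m % suc m        ≡⟨ cong (_% suc m) 1+i≡n ⟨
    suc (toℕ i) % suc m  ≡⟨ toℕ-σ i ⟨
    toℕ (σ i)            ∎)

  CycleAdj-σ : ∀ i → CycleAdj (suc m) i (σ i)
  CycleAdj-σ i with σ-cases i
  ... | inj₁ step = inj₂ (inj₁ step)
  ... | inj₂ wrap = inj₂ (inj₂ (inj₂ (inj₂ wrap)))

  CycleAdj-cases : ∀ {i j} → CycleAdj (suc m) i j → j ≡ i ⊎ j ≡ σ i ⊎ i ≡ σ j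
  CycleAdj-cases (inj₁ i≡j)                                = inj₁ (sym i≡j)
  CycleAdj-cases (inj₂ (inj₁ step))                        = inj₂ (inj₁ (step⇒σ step))
  CycleAdj-cases (inj₂ (inj₂ (inj₁ step)))                 = inj₂ (inj₂ (step⇒σ step))
  CycleAdj-cases (inj₂ (inj₂ (inj₂ (inj₁ (i≡0 , 1+j≡n))))) = inj₂ (inj₂ (wrap⇒σ i≡0 1+j≡n))
  CycleAdj-cases (inj₂ (inj₂ (inj₂ (inj₂ (j≡0 , 1+i≡n))))) = inj₂ (inj₁ (wrap⇒σ j≡0 1+i≡n))

CycleAdj-refl : ∀ {n} → Reflexive (CycleAdj n)
CycleAdj-refl = inj₁ refl

CycleAdj-sym : ∀ {n} → Symmetric (CycleAdj n)
CycleAdj-sym (inj₁ i≡j)                       = inj₁ (sym i≡j)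
CycleAdj-sym (inj₂ (inj₁ step))               = inj₂ (inj₂ (inj₁ step))
CycleAdj-sym (inj₂ (inj₂ (inj₁ step)))        = inj₂ (inj₁ step)
CycleAdj-sym (inj₂ (inj₂ (inj₂ (inj₁ wrap)))) = inj₂ (inj₂ (inj₂ (inj₂ wrap)))
CycleAdj-sym (inj₂ (inj₂ (inj₂ (inj₂ wrap)))) = inj₂ (inj₂ (inj₂ (inj₁ wrap)))

CycleAdj-π : ∀ {m} (i : Fin (suc m)) → CycleAdj (suc m) i (π i)
CycleAdj-π {m} i = CycleAdj-sym (subst (CycleAdj (suc m) (π i)) (σ-π i) (CycleAdj-σ (π i)))

module DiagonalPursuit
  (G : Graph) (τ₁ τ₂ : V G → V G)
  (Adj-refl : Reflexive (Adj G))
  (Adj-sym : Symmetric (Adj G))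
  (Adj-τ₁ : ∀ v → Adj G v (τ₁ v))
  (Adj-τ₂ : ∀ v → Adj G v (τ₂ v))
  (τ-moves : ∀ {r r'} → Adj G r r' → r' ≢ r →
             r' ≡ τ₁ r ⊎ r ≡ τ₁ r' ⊎ r' ≡ τ₂ r ⊎ r ≡ τ₂ r')
  (τ₁τ₂-comm : ∀ v → τ₁ (τ₂ v) ≡ τ₂ (τ₁ v))
  (τ₁-injective : Injective _≡_ _≡_ τ₁)
  (τ₂-injective : Injective _≡_ _≡_ τ₂)
  (τ₁τ₂-singleOrbit : SingleOrbit (τ₁ ∘ τ₂))
  where

  diagonal : ℕ → V G → V G
  diagonal = (τ₁ ∘ τ₂) ^_

  diagonal-τ₁ : ∀ k v → diagonal k (τ₁ v) ≡ τ₁ (diagonal k v)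
  diagonal-τ₁ zero    v = refl
  diagonal-τ₁ (suc k) v = begin
    τ₁ (τ₂ (diagonal k (τ₁ v)))  ≡⟨ cong (τ₁ ∘ τ₂) (diagonal-τ₁ k v) ⟩
    τ₁ (τ₂ (τ₁ (diagonal k v)))  ≡⟨ cong τ₁ (τ₁τ₂-comm (diagonal k v)) ⟨
    τ₁ (τ₁ (τ₂ (diagonal k v)))  ∎

  diagonal-τ₂ : ∀ k v → diagonal k (τ₂ v) ≡ τ₂ (diagonal k v)
  diagonal-τ₂ zero    v = refl
  diagonal-τ₂ (suc k) v = begin
    τ₁ (τ₂ (diagonal k (τ₂ v)))  ≡⟨ cong (τ₁ ∘ τ₂) (diagonal-τ₂ k v) ⟩
    τ₁ (τ₂ (τ₂ (diagonal k v)))  ≡⟨ τ₁τ₂-comm (τ₂ (diagonal k v)) ⟩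
    τ₂ (τ₁ (τ₂ (diagonal k v)))  ∎

  diagonal-reach : ∀ u v → ∃ λ k → diagonal (suc k) u ≡ v
  diagonal-reach u v with τ₁τ₂-singleOrbit (τ₁ (τ₂ u)) v
  ... | k , reach = k , (begin
    τ₁ (τ₂ (diagonal k u))   ≡⟨ cong τ₁ (diagonal-τ₂ k u) ⟨
    τ₁ (diagonal k (τ₂ u))   ≡⟨ diagonal-τ₁ k (τ₂ u) ⟨
    diagonal k (τ₁ (τ₂ u))   ≡⟨ reach ⟩
    v                        ∎)

  Adj-back : ∀ {τ : V G → V G} → (∀ v → Adj G v (τ v)) → ∀ {A A'} → A ≡ τ A' → Adj G A A'
  Adj-back Adj-τ refl = Adj-sym (Adj-τ _)

  Flanking : ℕ → ℕ → V G → V G → V G → Set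
  Flanking a b A B r = A ≡ diagonal a r × r ≡ diagonal b B

  Response : ℕ → ℕ → V G → V G → V G → Set
  Response a b A B r' = ∃₂ λ A' B' → Adj G A A' × Adj G B B' ×
                        (Flanking a (suc b) A' B' r' ⊎ Flanking (suc a) b A' B' r')

  module _ {a b : ℕ} {A B : V G} where

    respond-τ₁ : ∀ {r} → Flanking (suc a) (suc b) A B r → Response a b A B (τ₁ r)
    respond-τ₁ {r} (A≡ , r≡) =
      diagonal a (τ₁ r) , τ₁ B , Adj-back Adj-τ₂ A≡τ₂A' , Adj-τ₁ B , inj₁ (refl , τ₁r≡)
      where
      A≡τ₂A' : A ≡ τ₂ (diagonal a (τ₁ r))
      A≡τ₂A' = begin
        A                          ≡⟨ A≡ ⟩
        τ₁ (τ₂ (diagonal a r))     ≡⟨ τ₁τ₂-comm (diagonal a r) ⟩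
        τ₂ (τ₁ (diagonal a r))     ≡⟨ cong τ₂ (diagonal-τ₁ a r) ⟨
        τ₂ (diagonal a (τ₁ r))     ∎
      τ₁r≡ : τ₁ r ≡ diagonal (suc b) (τ₁ B)
      τ₁r≡ = trans (cong τ₁ r≡) (sym (diagonal-τ₁ (suc b) B))

    respond-τ₂ : ∀ {r} → Flanking (suc a) (suc b) A B r → Response a b A B (τ₂ r)
    respond-τ₂ {r} (A≡ , r≡) =
      diagonal a (τ₂ r) , τ₂ B , Adj-back Adj-τ₁ A≡τ₁A' , Adj-τ₂ B , inj₁ (refl , τ₂r≡)
      where
      A≡τ₁A' : A ≡ τ₁ (diagonal a (τ₂ r))
      A≡τ₁A' = trans A≡ (cong τ₁ (sym (diagonal-τ₂ a r)))
      τ₂r≡ : τ₂ r ≡ diagonal (suc b) (τ₂ B)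
      τ₂r≡ = trans (cong τ₂ r≡) (sym (diagonal-τ₂ (suc b) B))

    respond-τ₁⁻ : ∀ {r'} → Flanking (suc a) (suc b) A B (τ₁ r') → Response a b A B r'
    respond-τ₁⁻ {r'} (A≡ , τ₁r'≡) =
      diagonal (suc a) r' , τ₂ B , Adj-back Adj-τ₁ A≡τ₁A' , Adj-τ₂ B , inj₂ (refl , r'≡)
      where
      A≡τ₁A' : A ≡ τ₁ (diagonal (suc a) r')
      A≡τ₁A' = trans A≡ (diagonal-τ₁ (suc a) r')
      r'≡ : r' ≡ diagonal b (τ₂ B)
      r'≡ = τ₁-injective (begin
        τ₁ r'                     ≡⟨ τ₁r'≡ ⟩
        τ₁ (τ₂ (diagonal b B))    ≡⟨ cong τ₁ (diagonal-τ₂ b B) ⟨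
        τ₁ (diagonal b (τ₂ B))    ∎)

    respond-τ₂⁻ : ∀ {r'} → Flanking (suc a) (suc b) A B (τ₂ r') → Response a b A B r'
    respond-τ₂⁻ {r'} (A≡ , τ₂r'≡) =
      diagonal (suc a) r' , τ₁ B , Adj-back Adj-τ₂ A≡τ₂A' , Adj-τ₁ B , inj₂ (refl , r'≡)
      where
      A≡τ₂A' : A ≡ τ₂ (diagonal (suc a) r')
      A≡τ₂A' = trans A≡ (diagonal-τ₂ (suc a) r')
      r'≡ : r' ≡ diagonal b (τ₁ B)
      r'≡ = τ₂-injective (begin
        τ₂ r'                     ≡⟨ τ₂r'≡ ⟩
        τ₁ (τ₂ (diagonal b B))    ≡⟨ τ₁τ₂-comm (diagonal b B) ⟩
        τ₂ (τ₁ (diagonal b B))    ≡⟨ cong τ₂ (diagonal-τ₁ b B) ⟨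
        τ₂ (diagonal b (τ₁ B))    ∎)

    respond : ∀ {r r'} → Flanking (suc a) (suc b) A B r → Adj G r r' → r' ≢ r →
              Response a b A B r'
    respond fl r~r' r'≢r with τ-moves r~r' r'≢r
    ... | inj₁ refl               = respond-τ₁ fl
    ... | inj₂ (inj₁ refl)        = respond-τ₁⁻ fl
    ... | inj₂ (inj₂ (inj₁ refl)) = respond-τ₂ fl
    ... | inj₂ (inj₂ (inj₂ refl)) = respond-τ₂⁻ fl

  two-cops-step : ∀ {A B A' B'} → Adj G A A' → Adj G B B' →
                  CopStep G (A ∷ B ∷ []) (A' ∷ B' ∷ [])
  two-cops-step A~A' B~B' zero       = A~A'
  two-cops-step A~A' B~B' (suc zero) = B~B'

  WinsAfterEveryMove : V G → V G → V G → Set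
  WinsAfterEveryMove A B r = ∀ r' → Adj G r r' → r' ≢ r → CopsWin G (A ∷ B ∷ []) r'

  pursue : ∀ a b {A B r} → Flanking (suc a) (suc b) A B r → WinsAfterEveryMove A B r
  close-in : ∀ a b {A B r} → Flanking a b A B r → Caught G (A ∷ B ∷ []) r ⊎ WinsAfterEveryMove A B r

  pursue a b fl r' r~r' r'≢r with respond {a} {b} fl r~r' r'≢r
  ... | A' , B' , A~A' , B~B' , inj₁ fl' =
    move (A' ∷ B' ∷ []) (two-cops-step A~A' B~B') (close-in a (suc b) fl')
  ... | A' , B' , A~A' , B~B' , inj₂ fl' =
    move (A' ∷ B' ∷ []) (two-cops-step A~A' B~B') (close-in (suc a) b fl')

  close-in zero    b       (A≡r , _) = inj₁ (zero , A≡r)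
  close-in (suc a) zero    (_ , r≡B) = inj₁ (suc zero , sym r≡B)
  close-in (suc a) (suc b) fl        = inj₂ (pursue a b fl)

  two-cops-win : V G → SemiActiveCopWin G 2
  two-cops-win v = v ∷ v ∷ [] , start
    where
    start : ∀ r → CopsWin G (v ∷ v ∷ []) r
    start r with diagonal-reach r v | diagonal-reach v r
    ... | a , v≡ | b , r≡ =
      move (v ∷ v ∷ []) (two-cops-step Adj-refl Adj-refl) (close-in (suc a) (suc b) (sym v≡ , sym r≡))

Evasive : Graph → Set
Evasive G = ∀ c r → c ≢ r → ∃ λ r' → Adj G r r' × r' ≢ r × ¬ Adj G c r'

module _ (G : Graph) (Adj-refl : Reflexive (Adj G)) where

  CopStep-∷ : ∀ {k} {cs cs' : Cops G k} (c : V G) → CopStep G cs cs' → CopStep G (c ∷ cs) (c ∷ cs')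
  CopStep-∷ c step zero    = Adj-refl
  CopStep-∷ c step (suc i) = step i

  CopsWin-∷ : ∀ {k} {cs : Cops G k} {r} (c : V G) → CopsWin G cs r → CopsWin G (c ∷ cs) r
  CopsWin-∷ c (caught (i , cᵢ≡r))                = caught (suc i , cᵢ≡r)
  CopsWin-∷ c (move cs' step (inj₁ (i , c'ᵢ≡r))) = move (c ∷ cs') (CopStep-∷ c step) (inj₁ (suc i , c'ᵢ≡r))
  CopsWin-∷ c (move cs' step (inj₂ win))         =
    move (c ∷ cs') (CopStep-∷ c step) (inj₂ λ r' r~r' r'≢r → CopsWin-∷ c (win r' r~r' r'≢r))

  SemiActiveCopWin-suc : ∀ {k} → V G → SemiActiveCopWin G k → SemiActiveCopWin G (suc k)
  SemiActiveCopWin-suc c (cs , win) = c ∷ cs , λ r → CopsWin-∷ c (win r)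

  module _ (evasive : Evasive G) where

    evade : ∀ {cs : Cops G 1} {r} → ¬ Adj G (cs zero) r → ¬ CopsWin G cs r
    evade ¬c~r (caught (zero , c≡r))              = ¬c~r (subst (Adj G _) c≡r Adj-refl)
    evade ¬c~r (move cs' step (inj₁ (zero , c'≡r))) = ¬c~r (subst (Adj G _) c'≡r (step zero))
    evade ¬c~r (move cs' step (inj₂ win))
      with evasive (cs' zero) _ (λ c'≡r → ¬c~r (subst (Adj G _) c'≡r (step zero)))
    ... | r' , r~r' , r'≢r , ¬c'~r' = evade ¬c'~r' (win r' r~r' r'≢r)

    one-cop-loses : (∀ c → ∃ λ r → ¬ Adj G c r) → ¬ SemiActiveCopWin G 1
    one-cop-loses undominated (cs , win) with undominated (cs zero)
    ... | r , ¬c~r = evade ¬c~r (win r)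

    fewer-than-two-cops-lose : V G → (∀ c → ∃ λ r → ¬ Adj G c r) →
                               ∀ j → j < 2 → ¬ SemiActiveCopWin G j
    fewer-than-two-cops-lose v undominated zero          _ = one-cop-loses undominated ∘ SemiActiveCopWin-suc v
    fewer-than-two-cops-lose v undominated (suc zero)    _ = one-cop-loses undominated
    fewer-than-two-cops-lose v undominated (suc (suc j)) (s≤s (s≤s ()))

□-refl : ∀ {G H} → Reflexive (Adj H) → Reflexive (Adj (G □ H))
□-refl refl-H = inj₁ (refl , refl-H)

□-sym : ∀ {G H} → Symmetric (Adj G) → Symmetric (Adj H) → Symmetric (Adj (G □ H))
□-sym sym-G sym-H (inj₁ (refl , v~v')) = inj₁ (refl , sym-H v~v')
□-sym sym-G sym-H (inj₂ (u~u' , refl)) = inj₂ (sym-G u~u' , refl)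

map₁-injective : {A B C : Set} {f : A → B} → Injective _≡_ _≡_ f → Injective _≡_ _≡_ (map₁ {C = C} f)
map₁-injective f-injective fx≡fy = cong₂ _,_ (f-injective (,-injectiveˡ fx≡fy)) (,-injectiveʳ fx≡fy)

map₂-injective : {A B C : Set} {f : B → C} → Injective _≡_ _≡_ f → Injective _≡_ _≡_ (map₂ {A = A} f)
map₂-injective f-injective fx≡fy = cong₂ _,_ (,-injectiveˡ fx≡fy) (f-injective (,-injectiveʳ fx≡fy))

Torus : ℕ → ℕ → Graph
Torus m₁ m₂ = Cycle (suc m₁) □ Cycle (suc m₂)

module _ {m₁ m₂ : ℕ} where

  torus-refl : Reflexive (Adj (Torus m₁ m₂))
  torus-refl = □-refl {Cycle (suc m₁)} {Cycle (suc m₂)} CycleAdj-refl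

  torus-sym : Symmetric (Adj (Torus m₁ m₂))
  torus-sym = □-sym {Cycle (suc m₁)} {Cycle (suc m₂)} CycleAdj-sym CycleAdj-sym

  torus-moves : ∀ {r r'} → Adj (Torus m₁ m₂) r r' → r' ≢ r →
                r' ≡ map₁ σ r ⊎ r ≡ map₁ σ r' ⊎ r' ≡ map₂ σ r ⊎ r ≡ map₂ σ r'
  torus-moves (inj₁ (refl , y~y')) r'≢r with CycleAdj-cases y~y'
  ... | inj₁ refl        = ⊥-elim (r'≢r refl)
  ... | inj₂ (inj₁ refl) = inj₂ (inj₂ (inj₁ refl))
  ... | inj₂ (inj₂ refl) = inj₂ (inj₂ (inj₂ refl))
  torus-moves (inj₂ (x~x' , refl)) r'≢r with CycleAdj-cases x~x'
  ... | inj₁ refl        = ⊥-elim (r'≢r refl)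
  ... | inj₂ (inj₁ refl) = inj₁ refl
  ... | inj₂ (inj₂ refl) = inj₂ (inj₁ refl)

  torus-two-cops-win : Coprime (suc m₁) (suc m₂) → SemiActiveCopWin (Torus m₁ m₂) 2
  torus-two-cops-win coprime =
    DiagonalPursuit.two-cops-win (Torus m₁ m₂) (map₁ σ) (map₂ σ)
      torus-refl torus-sym
      (λ (x , _) → inj₂ (CycleAdj-σ x , refl)) (λ (_ , y) → inj₁ (refl , CycleAdj-σ y))
      torus-moves (λ _ → refl) (map₁-injective σ-injective) (map₂-injective σ-injective)
      (map-singleOrbit coprime σ-periodic σ-periodic σ-singleOrbit σ-singleOrbit)
      (zero , zero)

  torus-evasive : 1 < m₁ → 1 < m₂ → Evasive (Torus m₁ m₂)
  torus-evasive 1<m₁ 1<m₂ (p , q) (x , y) c≢r with q ≟ y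
  ... | yes refl = (x , σ y) , inj₁ (refl , CycleAdj-σ y) , σi≢i (<⇒≤ 1<m₂) y ∘ ,-injectiveʳ , λ where
    (inj₁ (refl , _))  → c≢r refl
    (inj₂ (_ , y≡σy)) → σi≢i (<⇒≤ 1<m₂) y (sym y≡σy)
  ... | no q≢y with p ≟ σ x
  ...   | no p≢σx = (σ x , y) , inj₂ (CycleAdj-σ x , refl) , σi≢i (<⇒≤ 1<m₁) x ∘ ,-injectiveˡ , λ where
    (inj₁ (p≡σx , _)) → p≢σx p≡σx
    (inj₂ (_ , q≡y))  → q≢y q≡y
  ...   | yes refl = (π x , y) , inj₂ (CycleAdj-π x , refl) , πi≢i (<⇒≤ 1<m₁) x ∘ ,-injectiveˡ , λ where
    (inj₁ (σx≡πx , _)) → σi≢πi 1<m₁ x σx≡πx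
    (inj₂ (_ , q≡y))   → q≢y q≡y

  torus-undominated : 0 < m₁ → 0 < m₂ → ∀ c → ∃ λ r → ¬ Adj (Torus m₁ m₂) c r
  torus-undominated 0<m₁ 0<m₂ (x , y) = (σ x , σ y) , λ where
    (inj₁ (x≡σx , _)) → σi≢i 0<m₁ x (sym x≡σx)
    (inj₂ (_ , y≡σy)) → σi≢i 0<m₂ y (sym y≡σy)

lemma3p14 : (n₁ n₂ : ℕ) → 3 ≤ n₁ → 3 ≤ n₂ → Coprime n₁ n₂ →
    SemiActiveCopNumber (Cycle n₁ □ Cycle n₂) 2
lemma3p14 (suc m₁) (suc m₂) (s≤s 1<m₁) (s≤s 1<m₂) coprime =
  torus-two-cops-win coprime ,
  fewer-than-two-cops-lose (Torus m₁ m₂) torus-refl (torus-evasive 1<m₁ 1<m₂)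
    (zero , zero) (torus-undominated (<⇒≤ 1<m₁) (<⇒≤ 1<m₂))
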